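{- Let $\mathcal{T}$ be a set of binary phylogenetic $X$-trees and let $S=\langle (x_1,y_1),\dots,(x_r,y_r),(x_{r+1},-)\rangle$ be a tree-child cherry picking sequence for $\mathcal{T}$. Then for all $j\in\{1,\dots,r\}$: (i) if $y\in X$ is not forbidden with respect to $S_{1,j}$, then $y$ is a leaf of every tree in $\mathcal{T}^{(j)}$; (ii) if $\{x,y\}$ is a cherry of $\mathcal{T}^{(j)}$, then $(x,y)$ or $(y,x)$ is a pair in $S_{j+1,r}$; (iii) if $\{x_j,y_j\}$ is a trivial cherry of $\mathcal{T}^{(j-1)}$, then $x_j$ is not a leaf of any tree in $\mathcal{T}^{(j)}$.
   Context: A binary phylogenetic $X'$-tree is a rooted tree whose root has out-degree 2, whose internal non-root nodes have in-degree 1 and out-degree 2, and whose leaves are bijectively labelled by $X'$ (or a single node if $|X'|=1$). A pair $\{x,y\}$ is a cherry of a tree if leaves $x,y$ are siblings. For a set of trees $\mathcal{T}$, $\{x,y\}$ is a cherry of $\mathcal{T}$ if it is a cherry of at least one tree in $\mathcal{T}$, and it is a trivial cherry of $\mathcal{T}$ if moreover it is a cherry of every tree in $\mathcal{T}$ that contains both $x$ and $y$. A cherry picking sequence is a sequence $S=\langle (x_1,y_1),\dots,(x_r,y_r),(x_{r+1},-),\dots,(x_s,-)\rangle$ with $x_i,y_i\in X$; $S_{i,j}$ denotes its subsequence of the $i$th through $j$th elements. Applying $S$ to a tree $T$: $T^{(0)}=T$, and for $j\le r$, if $\{x_j,y_j\}$ is a cherry of $T^{(j-1)}$ then $T^{(j)}$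 is obtained by deleting leaf $x_j$ and suppressing the parent of $y_j$, otherwise $T^{(j)}=T^{(j-1)}$; $T/S=T^{(r)}$; $\mathcal{T}^{(j)}=\{T^{(j)}:T\in\mathcal{T}\}$. $S$ is a cherry picking sequence for a set $\mathcal{T}$ of $X$-trees if $s>r$, $\{x_1,\dots,x_s\}=X$, and each $T/S$ ($T\in\mathcal{T}$) is a single leaf in $\{x_{r+1},\dots,x_s\}$. $S$ is tree-child if $s\le r+1$ and $y_j\ne x_i$ for all $1\le i<j\le s$. A leaf $y$ is forbidden with respect to a sequence $\langle (x_1,y_1),\dots,(x_j,y_j)\rangle$ if $y\in\{x_1,\dots,x_j\}$. -}

module Defs where

open import Data.Nat using (ℕ; _≡ᵇ_; _≤_; _∸_)
open import Data.Bool using (Bool; true; false; _∧_; _∨_; if_then_else_)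
open import Data.List using (List; []; _∷_; _++_; map; take; drop; length; foldl)
open import Data.List.Membership.Propositional using (_∈_; _∉_)
open import Data.List.Relation.Unary.Unique.Propositional using (Unique)
open import Data.List.Relation.Binary.Permutation.Propositional using (_↭_)
open import Data.Product using (_×_; _,_; proj₁; proj₂; Σ; ∃)
open import Data.Sum using (_⊎_)
open import Relation.Binary.PropositionalEquality using (_≡_)

-- Leaf labels are natural numbers.  A rooted binary tree: either a single
-- leaf, or a node with exactly two children (order of children irrelevant
-- for all notions below).
data Tree : Set where
  leaf : ℕ → Tree
  node : Tree → Tree → Tree

leaves : Tree → List ℕ
leaves (leaf x) = x ∷ []
leaves (node l r) = leaves l ++ leaves r

IsPhyloTree : List ℕ → Tree → Set
IsPhyloTree X′ T = Unique (leaves T) × (leaves T ↭ X′)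

data Cherry (x y : ℕ) : Tree → Set where
  here₁ : Cherry x y (node (leaf x) (leaf y))
  here₂ : Cherry x y (node (leaf y) (leaf x))
  left  : ∀ {l r} → Cherry x y l → Cherry x y (node l r)
  right : ∀ {l r} → Cherry x y r → Cherry x y (node l r)

isLeaf : ℕ → Tree → Bool
isLeaf x (leaf a) = a ≡ᵇ x
isLeaf x (node _ _) = false

-- picking (x,y): if {x,y} is a cherry, delete leaf x and suppress the parent
-- of y (i.e. replace the cherry node by leaf y); otherwise unchanged.
-- (Labels are distinct, so at most one node is such a cherry.)
pick : ℕ → ℕ → Tree → Tree
pick x y (leaf z) = leaf z
pick x y (node l r) =
  if (isLeaf x l ∧ isLeaf y r) ∨ (isLeaf y l ∧ isLeaf x r)
  then leaf y
  else node (pick x y l) (pick x y r)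

-- T / S for a list of pairs S (the "(x,-)" elements do not change trees)
applySeq : List (ℕ × ℕ) → Tree → Tree
applySeq S T = foldl (λ t p → pick (proj₁ p) (proj₂ p) t) T S

CherryOfSet : ℕ → ℕ → List Tree → Set
CherryOfSet x y 𝒯 = Σ Tree λ T → T ∈ 𝒯 × Cherry x y T

TrivialCherry : ℕ → ℕ → List Tree → Set
TrivialCherry x y 𝒯 =
  CherryOfSet x y 𝒯 ×
  (∀ T → T ∈ 𝒯 → x ∈ leaves T → y ∈ leaves T → Cherry x y T)

-- Sequence S = ⟨(x₁,y₁),…,(x_r,y_r),(x_{r+1},-)⟩ given as the list of pairs
-- ps and the final element last.  Labels occurring in S:
seqLabels : List (ℕ × ℕ) → ℕ → List ℕ
seqLabels ps last = map proj₁ ps ++ (last ∷ [])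

IsCPS : List ℕ → List Tree → List (ℕ × ℕ) → ℕ → Set
IsCPS X 𝒯 ps last =
  (∀ p → p ∈ ps → proj₁ p ∈ X × proj₂ p ∈ X) ×
  (∀ z → z ∈ seqLabels ps last → z ∈ X) ×
  (∀ z → z ∈ X → z ∈ seqLabels ps last) ×
  (∀ T → T ∈ 𝒯 → applySeq ps T ≡ leaf last)

-- tree-child (with s = r+1): y_j ≠ x_i for all i < j ≤ r
IsTreeChild : List (ℕ × ℕ) → Set
IsTreeChild ps = ∀ pre x y suf → ps ≡ pre ++ (x , y) ∷ suf → y ∉ map proj₁ pre

module Submission where

-- Picking (a, b) deletes only the leaf a, and a cherry {x, y} survives every pick
-- other than (x, y) or (y, x).  Hence (i) a leaf that is never picked stays, and
-- (ii) since the rest of the sequence reduces each tree to a single leaf, which has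
-- no cherries, every cherry present after step j must be picked later.  For (iii),
-- the tree-child condition keeps y_j present up to step j, so triviality makes
-- {x_j, y_j} a cherry of every tree still containing x_j, and picking a cherry of a
-- tree with distinct labels removes x_j.

open import Defs
open import Data.Bool using (T; true; false; _∧_; _∨_)
open import Data.Bool.Properties using (T-≡; T-∧; T-∨)
open import Data.Empty using (⊥-elim)
open import Data.Unit using (⊤; tt)
open import Data.List using (List; []; _∷_; _++_; map)
open import Data.List.Membership.Propositional using (_∈_; _∉_)
open import Data.List.Membership.Propositional.Properties using (∈-++⁻; ∈-++⁺ˡ; ∈-++⁺ʳ; ∈-map⁺; ∈-map⁻)
open import Data.List.Properties using (foldl-++; ++-assoc)
open import Data.List.Relation.Binary.Disjoint.Propositional using (Disjoint)
open import Data.List.Relation.Binary.Permutation.Propositional using (↭-sym)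
open import Data.List.Relation.Binary.Permutation.Propositional.Properties using (∈-resp-↭)
open import Data.List.Relation.Unary.Any using (here; there)
import Data.List.Relation.Unary.All.Properties as All
open import Data.List.Relation.Unary.All using (lookup)
open import Data.List.Relation.Unary.AllPairs using ([]; _∷_)
open import Data.List.Relation.Unary.Unique.Propositional using (Unique)
open import Data.Nat using (ℕ)
open import Data.Nat.Properties using (≡ᵇ⇒≡; ≡⇒≡ᵇ)
open import Data.Product as Product using (_×_; _,_; proj₁; proj₂)
open import Data.Sum as Sum using (_⊎_; inj₁; inj₂)
open import Function using (_∘_)
open import Function.Bundles using (_⇔_; mk⇔; Equivalence)
open import Relation.Binary.PropositionalEquality
  using (_≡_; _≢_; refl; sym; cong; subst; module ≡-Reasoning)
open import Relation.Nullary using (¬_)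

open Equivalence using (to; from)
open ≡-Reasoning

private
  variable
    a b x y z : ℕ
    l r t : Tree

T-isLeaf : T (isLeaf a t) ⇔ t ≡ leaf a
T-isLeaf {a} {leaf z} = mk⇔ (cong leaf ∘ ≡ᵇ⇒≡ z a) (λ { refl → ≡⇒≡ᵇ a a refl })
T-isLeaf {t = node _ _} = mk⇔ (λ ()) (λ ())

SiblingLeaves : ℕ → ℕ → Tree → Tree → Set
SiblingLeaves a b l r = (l ≡ leaf a × r ≡ leaf b) ⊎ (l ≡ leaf b × r ≡ leaf a)

T-siblings : ∀ {a b l r} → T ((isLeaf a l ∧ isLeaf b r) ∨ (isLeaf b l ∧ isLeaf a r)) ⇔ SiblingLeaves a b l r
T-siblings = mk⇔
  (Sum.map leaves-sound leaves-sound ∘ to T-∨)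
  (from T-∨ ∘ Sum.map leaves-complete leaves-complete)
  where
  leaves-sound : ∀ {c d l r} → T (isLeaf c l ∧ isLeaf d r) → l ≡ leaf c × r ≡ leaf d
  leaves-sound = Product.map (to T-isLeaf) (to T-isLeaf) ∘ to T-∧
  leaves-complete : ∀ {c d l r} → l ≡ leaf c × r ≡ leaf d → T (isLeaf c l ∧ isLeaf d r)
  leaves-complete = from T-∧ ∘ Product.map (from T-isLeaf) (from T-isLeaf)

data PickNode (a b : ℕ) : Tree → Tree → Tree → Set where
  siblings-ab : PickNode a b (leaf a) (leaf b) (leaf b)
  siblings-ba : PickNode a b (leaf b) (leaf a) (leaf b)
  recurse     : ¬ SiblingLeaves a b l r → PickNode a b l r (node (pick a b l) (pick a b r))

pick-node : ∀ a b l r → PickNode a b l r (pick a b (node l r))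
pick-node a b l r with (isLeaf a l ∧ isLeaf b r) ∨ (isLeaf b l ∧ isLeaf a r) in e
... | false = recurse (λ s → subst T e (from T-siblings s))
... | true with to (T-siblings {a} {b} {l} {r}) (from T-≡ e)
...   | inj₁ (refl , refl) = siblings-ab
...   | inj₂ (refl , refl) = siblings-ba

pick-siblings : SiblingLeaves a b l r → pick a b (node l r) ≡ leaf b
pick-siblings {a} {b} {l} {r} s with pick a b (node l r) | pick-node a b l r
... | _ | siblings-ab = refl
... | _ | siblings-ba = refl
... | _ | recurse ¬s = ⊥-elim (¬s s)

pick-non-siblings : ¬ SiblingLeaves a b l r → pick a b (node l r) ≡ node (pick a b l) (pick a b r)
pick-non-siblings {a} {b} {l} {r} ¬s with pick a b (node l r) | pick-node a b l r
... | _ | siblings-ab = ⊥-elim (¬s (inj₁ (refl , refl)))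
... | _ | siblings-ba = ⊥-elim (¬s (inj₂ (refl , refl)))
... | _ | recurse _ = refl

no-cherry-in-leaf : ¬ Cherry x y (leaf z)
no-cherry-in-leaf ()

cherry⇒¬siblingsˡ : Cherry x y l → ¬ SiblingLeaves a b l r
cherry⇒¬siblingsˡ c (inj₁ (refl , _)) = no-cherry-in-leaf c
cherry⇒¬siblingsˡ c (inj₂ (refl , _)) = no-cherry-in-leaf c

cherry⇒¬siblingsʳ : Cherry x y r → ¬ SiblingLeaves a b l r
cherry⇒¬siblingsʳ c (inj₁ (_ , refl)) = no-cherry-in-leaf c
cherry⇒¬siblingsʳ c (inj₂ (_ , refl)) = no-cherry-in-leaf c

cherry⇒∈leaves : Cherry x y t → x ∈ leaves t
cherry⇒∈leaves here₁ = here refl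
cherry⇒∈leaves here₂ = there (here refl)
cherry⇒∈leaves (left c) = ∈-++⁺ˡ (cherry⇒∈leaves c)
cherry⇒∈leaves {t = node l _} (right c) = ∈-++⁺ʳ (leaves l) (cherry⇒∈leaves c)

pick-leaves⊆ : ∀ t → z ∈ leaves (pick a b t) → z ∈ leaves t
pick-leaves⊆ (leaf _) m = m
pick-leaves⊆ {a = a} {b} (node l r) m with pick a b (node l r) | pick-node a b l r
... | _ | siblings-ab = there m
... | _ | siblings-ba = ∈-++⁺ˡ m
... | _ | recurse _ with ∈-++⁻ (leaves (pick a b l)) m
...   | inj₁ m = ∈-++⁺ˡ (pick-leaves⊆ l m)
...   | inj₂ m = ∈-++⁺ʳ (leaves l) (pick-leaves⊆ r m)

pick-keeps : ∀ t → z ∈ leaves t → z ≢ a → z ∈ leaves (pick a b t)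
pick-keeps (leaf _) m _ = m
pick-keeps {a = a} {b} (node l r) m z≢a with pick a b (node l r) | pick-node a b l r
... | _ | siblings-ab with m
...   | here refl = ⊥-elim (z≢a refl)
...   | there m = m
pick-keeps (node l r) m z≢a | _ | siblings-ba with m
...   | here z≡b = here z≡b
...   | there (here refl) = ⊥-elim (z≢a refl)
pick-keeps {a = a} {b} (node l r) m z≢a | _ | recurse _ with ∈-++⁻ (leaves l) m
...   | inj₁ m = ∈-++⁺ˡ (pick-keeps l m z≢a)
...   | inj₂ m = ∈-++⁺ʳ (leaves (pick a b l)) (pick-keeps r m z≢a)

-- A structural form of Unique (leaves t), convenient because pick preserves it.
DistinctLeaves : Tree → Set
DistinctLeaves (leaf _) = ⊤
DistinctLeaves (node l r) = DistinctLeaves l × DistinctLeaves r × Disjoint (leaves l) (leaves r)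

Unique-++⁻ : ∀ (xs : List ℕ) {ys} → Unique (xs ++ ys) → Unique xs × Unique ys × Disjoint xs ys
Unique-++⁻ [] u = [] , u , λ { (() , _) }
Unique-++⁻ (x ∷ xs) {ys} (x∉ ∷ u) with Unique-++⁻ xs u
... | uxs , uys , xs#ys = All.++⁻ˡ xs x∉ ∷ uxs , uys , disjoint
  where
  disjoint : Disjoint (x ∷ xs) ys
  disjoint (here refl , v∈ys) = lookup (All.++⁻ʳ xs x∉) v∈ys refl
  disjoint (there v∈xs , v∈ys) = xs#ys (v∈xs , v∈ys)

unique⇒distinctLeaves : ∀ t → Unique (leaves t) → DistinctLeaves t
unique⇒distinctLeaves (leaf _) _ = tt
unique⇒distinctLeaves (node l r) u with Unique-++⁻ (leaves l) u
... | ul , ur , l#r = unique⇒distinctLeaves l ul , unique⇒distinctLeaves r ur , l#r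

pick-distinct : ∀ t → DistinctLeaves t → DistinctLeaves (pick a b t)
pick-distinct (leaf _) _ = tt
pick-distinct {a} {b} (node l r) (dl , dr , l#r) with pick a b (node l r) | pick-node a b l r
... | _ | siblings-ab = tt
... | _ | siblings-ba = tt
... | _ | recurse _ = pick-distinct l dl , pick-distinct r dr ,
                      λ (ml , mr) → l#r (pick-leaves⊆ l ml , pick-leaves⊆ r mr)

pick-removes : ∀ t → DistinctLeaves t → Cherry a b t → a ∉ leaves (pick a b t)
pick-removes {a} {b} _ (_ , _ , l#r) here₁ m =
  l#r (here refl , subst (λ t → a ∈ leaves t) (pick-siblings {a = a} {b = b} (inj₁ (refl , refl))) m)
pick-removes {a} {b} _ (_ , _ , l#r) here₂ m =
  l#r (subst (λ t → a ∈ leaves t) (pick-siblings {a = a} {b = b} (inj₂ (refl , refl))) m , here refl)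
pick-removes {a} {b} (node l r) (dl , _ , l#r) (left c) m
  rewrite pick-non-siblings {a = a} {b = b} {r = r} (cherry⇒¬siblingsˡ c)
  with ∈-++⁻ (leaves (pick a b l)) m
... | inj₁ ml = pick-removes l dl c ml
... | inj₂ mr = l#r (cherry⇒∈leaves c , pick-leaves⊆ r mr)
pick-removes {a} {b} (node l r) (_ , dr , l#r) (right c) m
  rewrite pick-non-siblings {a = a} {b = b} {l = l} (cherry⇒¬siblingsʳ c)
  with ∈-++⁻ (leaves (pick a b l)) m
... | inj₁ ml = l#r (pick-leaves⊆ l ml , cherry⇒∈leaves c)
... | inj₂ mr = pick-removes r dr c mr

pick-cherry : ∀ {a b x y t} → Cherry x y t → (x , y) ≡ (a , b) ⊎ (y , x) ≡ (a , b) ⊎ Cherry x y (pick a b t)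
pick-cherry {a} {b} {x} {y} here₁ with pick a b (node (leaf x) (leaf y)) | pick-node a b (leaf x) (leaf y)
... | _ | siblings-ab = inj₁ refl
... | _ | siblings-ba = inj₂ (inj₁ refl)
... | _ | recurse _ = inj₂ (inj₂ here₁)
pick-cherry {a} {b} {x} {y} here₂ with pick a b (node (leaf y) (leaf x)) | pick-node a b (leaf y) (leaf x)
... | _ | siblings-ab = inj₂ (inj₁ refl)
... | _ | siblings-ba = inj₁ refl
... | _ | recurse _ = inj₂ (inj₂ here₂)
pick-cherry {a} {b} {t = node l r} (left c)
  rewrite pick-non-siblings {a = a} {b = b} {r = r} (cherry⇒¬siblingsˡ c) =
  Sum.map₂ (Sum.map₂ left) (pick-cherry c)
pick-cherry {a} {b} {t = node l r} (right c)
  rewrite pick-non-siblings {a = a} {b = b} {l = l} (cherry⇒¬siblingsʳ c) =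
  Sum.map₂ (Sum.map₂ right) (pick-cherry c)

pick-removes-trivial : ∀ t → DistinctLeaves t → y ∈ leaves t →
  (x ∈ leaves t → y ∈ leaves t → Cherry x y t) → x ∉ leaves (pick x y t)
pick-removes-trivial t d y∈t trivial x∈pick =
  pick-removes t d (trivial (pick-leaves⊆ t x∈pick) y∈t) x∈pick

applySeq-++ : ∀ qs rs t → applySeq (qs ++ rs) t ≡ applySeq rs (applySeq qs t)
applySeq-++ qs rs t = foldl-++ _ t qs rs

applySeq-keeps : ∀ qs t → z ∈ leaves t → z ∉ map proj₁ qs → z ∈ leaves (applySeq qs t)
applySeq-keeps [] _ z∈t _ = z∈t
applySeq-keeps ((a , b) ∷ qs) t z∈t z∉qs =
  applySeq-keeps qs (pick a b t) (pick-keeps t z∈t (z∉qs ∘ here)) (z∉qs ∘ there)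

applySeq-distinct : ∀ qs t → DistinctLeaves t → DistinctLeaves (applySeq qs t)
applySeq-distinct [] _ d = d
applySeq-distinct ((a , b) ∷ qs) t d = applySeq-distinct qs (pick a b t) (pick-distinct t d)

applySeq-cherry : ∀ qs → Cherry x y t →
  (x , y) ∈ qs ⊎ (y , x) ∈ qs ⊎ Cherry x y (applySeq qs t)
applySeq-cherry [] c = inj₂ (inj₂ c)
applySeq-cherry ((a , b) ∷ qs) c with pick-cherry {a} {b} c
... | inj₁ xy≡ab = inj₁ (here xy≡ab)
... | inj₂ (inj₁ yx≡ab) = inj₂ (inj₁ (here yx≡ab))
... | inj₂ (inj₂ c′) = Sum.map there (Sum.map₁ there) (applySeq-cherry qs c′)

cherry-picked-later : ∀ qs → applySeq qs t ≡ leaf z → Cherry x y t → (x , y) ∈ qs ⊎ (y , x) ∈ qs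
cherry-picked-later qs done c with applySeq-cherry qs c
... | inj₁ xy∈qs = inj₁ xy∈qs
... | inj₂ (inj₁ yx∈qs) = inj₂ yx∈qs
... | inj₂ (inj₂ c′) = ⊥-elim (no-cherry-in-leaf (subst (Cherry _ _) done c′))

proposition5 : (X : List ℕ) → (𝒯 : List Tree) → (ps : List (ℕ × ℕ)) → (last : ℕ)
    → (∀ T → T ∈ 𝒯 → IsPhyloTree X T)
    → IsCPS X 𝒯 ps last
    → IsTreeChild ps
    → ∀ pre xj yj suf → ps ≡ pre ++ (xj , yj) ∷ suf
    → ((y : ℕ) → y ∈ X → y ∉ map proj₁ (pre ++ (xj , yj) ∷ [])
         → ∀ T → T ∈ 𝒯 → y ∈ leaves (applySeq (pre ++ (xj , yj) ∷ []) T))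
      × ((x y : ℕ) → CherryOfSet x y (map (applySeq (pre ++ (xj , yj) ∷ [])) 𝒯)
         → (x , y) ∈ suf ⊎ (y , x) ∈ suf)
      × (TrivialCherry xj yj (map (applySeq pre) 𝒯)
         → ∀ T → T ∈ 𝒯 → xj ∉ leaves (applySeq (pre ++ (xj , yj) ∷ []) T))
proposition5 X 𝒯 ps last phylo (pairs∈X , _ , _ , reduces) treeChild pre xj yj suf refl =
  unforbidden-kept , cherry-picked-in-suf , trivial-cherry-removed
  where
  S₁ⱼ = pre ++ (xj , yj) ∷ []

  ∈X⇒∈leaves : ∀ {T y} → T ∈ 𝒯 → y ∈ X → y ∈ leaves T
  ∈X⇒∈leaves T∈𝒯 = ∈-resp-↭ (↭-sym (proj₂ (phylo _ T∈𝒯)))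

  unforbidden-kept : (y : ℕ) → y ∈ X → y ∉ map proj₁ S₁ⱼ → ∀ T → T ∈ 𝒯 → y ∈ leaves (applySeq S₁ⱼ T)
  unforbidden-kept y y∈X y∉S T T∈𝒯 = applySeq-keeps S₁ⱼ T (∈X⇒∈leaves T∈𝒯 y∈X) y∉S

  suf-reduces : ∀ {T} → T ∈ 𝒯 → applySeq suf (applySeq S₁ⱼ T) ≡ leaf last
  suf-reduces {T} T∈𝒯 = begin
    applySeq suf (applySeq S₁ⱼ T)  ≡⟨ sym (applySeq-++ S₁ⱼ suf T) ⟩
    applySeq (S₁ⱼ ++ suf) T        ≡⟨ cong (λ qs → applySeq qs T) (++-assoc pre _ suf) ⟩
    applySeq ps T                  ≡⟨ reduces T T∈𝒯 ⟩
    leaf last                      ∎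

  cherry-picked-in-suf : (x y : ℕ) → CherryOfSet x y (map (applySeq S₁ⱼ) 𝒯) → (x , y) ∈ suf ⊎ (y , x) ∈ suf
  cherry-picked-in-suf x y (_ , T′∈ , c) with ∈-map⁻ (applySeq S₁ⱼ) T′∈
  ... | T , T∈𝒯 , refl = cherry-picked-later suf (suf-reduces T∈𝒯) c

  trivial-cherry-removed : TrivialCherry xj yj (map (applySeq pre) 𝒯) → ∀ T → T ∈ 𝒯 → xj ∉ leaves (applySeq S₁ⱼ T)
  trivial-cherry-removed (_ , trivial) T T∈𝒯 =
    subst (λ t → xj ∉ leaves t) (sym (applySeq-++ pre _ T))
      (pick-removes-trivial (applySeq pre T) distinct yj-kept (trivial _ (∈-map⁺ (applySeq pre) T∈𝒯)))
    where
    distinct : DistinctLeaves (applySeq pre T)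
    distinct = applySeq-distinct pre T (unique⇒distinctLeaves T (proj₁ (phylo T T∈𝒯)))
    yj-kept : yj ∈ leaves (applySeq pre T)
    yj-kept = applySeq-keeps pre T
      (∈X⇒∈leaves T∈𝒯 (proj₂ (pairs∈X _ (∈-++⁺ʳ pre (here refl)))))
      (treeChild pre xj yj suf refl)
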